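{- Let $t$ be a positive integer and $\beta<1$. Then there exist $n_0$ and a constant $c>0$ depending only on $\beta$ and $t$ such that the following holds for all $n\ge n_0$. Let $G$ be an $n$-vertex $B_t$-free graph with maximum degree $\Delta$ satisfying $n/2<\Delta<\beta n$. Then $|E(G)|\le \Delta(n-\Delta)$. Moreover, if $G$ contains a triangle, then $|E(G)|\le \Delta(n-\Delta)-cn$.
   Context: The book $B_t$ is the graph consisting of $t$ triangles sharing a common edge (i.e., an edge $xy$ together with $t$ further vertices each adjacent to both $x$ and $y$). A graph is $B_t$-free if it contains no subgraph isomorphic to $B_t$. -}

module Defs where

open import Data.Nat using (ℕ; zero; suc; _+_; _⊔_)
open import Data.Bool using (Bool; true; false; _∧_)
open import Data.Fin using (Fin; zero; suc; toℕ)
open import Data.Product using (Σ; ∃; _×_; _,_)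
open import Function.Definitions using (Injective)
open import Relation.Binary.PropositionalEquality using (_≡_)
open import Relation.Nullary using (¬_)

record Graph (n : ℕ) : Set where
  field
    adj    : Fin n → Fin n → Bool
    sym    : ∀ i j → adj i j ≡ adj j i
    irrefl : ∀ i → adj i i ≡ false
open Graph public

countFin : ∀ {n} → (Fin n → Bool) → ℕ
countFin {zero}  p = 0
countFin {suc n} p with p zero
... | true  = suc (countFin (λ i → p (suc i)))
... | false = countFin (λ i → p (suc i))

sumFin : ∀ {n} → (Fin n → ℕ) → ℕ
sumFin {zero}  f = 0
sumFin {suc n} f = f zero + sumFin (λ i → f (suc i))

maxFin : ∀ {n} → (Fin n → ℕ) → ℕ
maxFin {zero}  f = 0
maxFin {suc n} f = f zero ⊔ maxFin (λ i → f (suc i))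

_<ᵇF_ : ∀ {n} → Fin n → Fin n → Bool
i <ᵇF j = Data.Nat._<ᵇ_ (toℕ i) (toℕ j)

degree : ∀ {n} → Graph n → Fin n → ℕ
degree G v = countFin (adj G v)

maxDegree : ∀ {n} → Graph n → ℕ
maxDegree G = maxFin (degree G)

edgeCount : ∀ {n} → Graph n → ℕ
edgeCount G = sumFin (λ i → countFin (λ j → (i <ᵇF j) ∧ adj G i j))

-- G contains the book B_t: an edge xy and t distinct vertices adjacent to both x and y
-- (they differ from x and y automatically since the graph is loopless).
ContainsBook : ∀ {n} → ℕ → Graph n → Set
ContainsBook {n} t G =
  Σ (Fin n) λ x → Σ (Fin n) λ y → adj G x y ≡ true ×
    Σ (Fin t → Fin n) λ f → Injective _≡_ _≡_ f ×
      (∀ k → adj G x (f k) ≡ true × adj G y (f k) ≡ true)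

BookFree : ∀ {n} → ℕ → Graph n → Set
BookFree t G = ¬ ContainsBook t G

HasTriangle : ∀ {n} → Graph n → Set
HasTriangle {n} G = Σ (Fin n) λ x → Σ (Fin n) λ y → Σ (Fin n) λ z →
  adj G x y ≡ true × adj G y z ≡ true × adj G x z ≡ true

module Submission where

-- Fix a vertex v of maximum degree Δ, and let A = N(v), B = V ∖ A, so |B| = n − Δ. Counting ordered
-- pairs, with e(X,Y) the edges and ē(X,Y) the non-edges from X to Y,
--   2(Δ(n − Δ) − |E|) = (ē(A,B) − e(A,A)) + (ē(B,A) − e(B,B)).
-- A vertex of B has degree at most Δ = |A|, so it has at most as many neighbours in B as
-- non-neighbours in A: e(B,B) ≤ ē(B,A). Since G is B_t-free, a vertex of A has fewer than t neighbours
-- in A (they are common neighbours with v), and for each edge xy all but fewer than t vertices of B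
-- are non-neighbours of x or of y. Summing the latter over the edges inside A gives
-- e(A,A)·|B| ≤ 2t·ē(A,B) + t·e(A,A), hence e(A,A) ≤ ē(A,B) as |B| ≥ n/b ≥ 3t. If G has a triangle,
-- either e(A,A) > 0 and that estimate leaves slack of order n/(tb), or the triangle has an edge yz
-- inside B, and the non-neighbours of y and z in A alone number at least Δ − t > n/2 − t.

open import Defs hiding (sym)
open import Data.Bool using (Bool; true; false; _∧_; not)
open import Data.Bool.Properties using (∧-conicalˡ; ∧-conicalʳ)
open import Data.Empty using (⊥-elim)
open import Data.Fin using (Fin; zero; suc; toℕ; punchIn; punchOut)
open import Data.Fin.Properties using (punchIn-punchOut; suc-injective; toℕ-injective)
open import Data.Nat using (ℕ; zero; suc; _+_; _*_; _∸_; _≤_; _<_; z≤n; s≤s; s≤s⁻¹; z<s; NonZero; >-nonZero; >-nonZero⁻¹)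
open import Data.Nat.Properties hiding (suc-injective)
open import Data.Nat.Tactic.RingSolver using (solve-∀)
open import Algebra.Properties.Semiring.Sum +-*-semiring
  using (sum; sum-syntax; sum-cong-≗; sum-remove; ∑-distrib-+; ∑-comm; *-distribˡ-sum; *-distribʳ-sum)
open import Data.Product using (Σ; _×_; _,_)
open import Data.Sum using (inj₁; inj₂)
open import Function using (_∘_)
open import Function.Definitions using (Injective)
open import Relation.Binary.PropositionalEquality
open import Relation.Nullary using (contradiction)
open import Relation.Nullary.Reflects using (ofʸ; ofⁿ)

sumFin≡sum : ∀ {n} (f : Fin n → ℕ) → sumFin f ≡ sum f
sumFin≡sum {zero}  f = refl
sumFin≡sum {suc n} f = cong (f zero +_) (sumFin≡sum (f ∘ suc))

sum-mono-≤ : ∀ {n} {f g : Fin n → ℕ} → (∀ i → f i ≤ g i) → sum f ≤ sum g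
sum-mono-≤ {zero}  f≤g = z≤n
sum-mono-≤ {suc n} f≤g = +-mono-≤ (f≤g zero) (sum-mono-≤ (f≤g ∘ suc))

term≤sum : ∀ {n} (f : Fin n → ℕ) i → f i ≤ sum f
term≤sum {suc n} f i = ≤-trans (m≤m+n (f i) _) (≤-reflexive (sym (sum-remove f)))

two-terms≤sum : ∀ {n} (f : Fin n → ℕ) {i j} → i ≢ j → f i + f j ≤ sum f
two-terms≤sum {suc n} f {i} {j} i≢j = begin
  f i + f j                                   ≡⟨ cong (λ k → f i + f k) (punchIn-punchOut i≢j) ⟨
  f i + f (punchIn i (punchOut i≢j))          ≤⟨ +-monoʳ-≤ (f i) (term≤sum (f ∘ punchIn i) (punchOut i≢j)) ⟩
  f i + sum (f ∘ punchIn i)                   ≡⟨ sum-remove f ⟨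
  sum f                                       ∎
  where open ≤-Reasoning

∑∑-distrib-+ : ∀ {m n} (f g : Fin m → Fin n → ℕ) →
  ∑[ i < m ] ∑[ j < n ] (f i j + g i j) ≡ ∑[ i < m ] ∑[ j < n ] f i j + ∑[ i < m ] ∑[ j < n ] g i j
∑∑-distrib-+ f g = trans (sum-cong-≗ (λ i → ∑-distrib-+ (f i) (g i)))
                         (∑-distrib-+ (λ i → ∑[ j < _ ] f i j) (λ i → ∑[ j < _ ] g i j))

∑∑-symmetric-weight : ∀ {n} (w : Fin n → Fin n → ℕ) (f : Fin n → ℕ) → (∀ i j → w i j ≡ w j i) →
  ∑[ i < n ] ∑[ j < n ] (w i j * f j) ≡ ∑[ i < n ] ∑[ j < n ] (w i j * f i)
∑∑-symmetric-weight w f w-sym = trans (∑-comm (λ i j → w i j * f j))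
  (sum-cong-≗ (λ j → sum-cong-≗ (λ i → cong (_* f j) (w-sym i j))))

f≤maxFin : ∀ {n} (f : Fin n → ℕ) i → f i ≤ maxFin f
f≤maxFin f zero    = m≤m⊔n _ _
f≤maxFin f (suc i) = ≤-trans (f≤maxFin (f ∘ suc) i) (m≤n⊔m _ _)

maxFin-attained : ∀ {n} (f : Fin (suc n) → ℕ) → Σ (Fin (suc n)) λ i → f i ≡ maxFin f
maxFin-attained {zero}  f = zero , sym (⊔-identityʳ (f zero))
maxFin-attained {suc n} f with ⊔-sel (f zero) (maxFin (f ∘ suc))
... | inj₁ max≡f₀   = zero , sym max≡f₀
... | inj₂ max≡rest = let i , fi≡ = maxFin-attained (f ∘ suc) in suc i , trans fi≡ (sym max≡rest)

χ : Bool → ℕ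
χ true  = 1
χ false = 0

χ-∧ : ∀ x y → χ (x ∧ y) ≡ χ x * χ y
χ-∧ true  y = sym (+-identityʳ (χ y))
χ-∧ false y = refl

χ-+-not : ∀ x → χ x + χ (not x) ≡ 1
χ-+-not true  = refl
χ-+-not false = refl

χ-partitionˡ : ∀ x c → χ x * c + χ (not x) * c ≡ c
χ-partitionˡ true  c = trans (+-identityʳ _) (+-identityʳ c)
χ-partitionˡ false c = +-identityʳ c

χ-partitionʳ : ∀ c x → c * χ x + c * χ (not x) ≡ c
χ-partitionʳ c x = trans (cong₂ _+_ (*-comm c _) (*-comm c _)) (χ-partitionˡ x c)

χ-≤-cover : ∀ w p q → χ w ≤ χ w * χ (not p) + χ w * χ (not q) + χ (p ∧ q)
χ-≤-cover false p     q     = z≤n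
χ-≤-cover true  false q     = s≤s z≤n
χ-≤-cover true  true  false = s≤s z≤n
χ-≤-cover true  true  true  = s≤s z≤n

χ*-mono-≤ : ∀ p {c d} → (p ≡ true → c ≤ d) → χ p * c ≤ χ p * d
χ*-mono-≤ true  c≤d = *-monoʳ-≤ 1 (c≤d refl)
χ*-mono-≤ false c≤d = z≤n

χ*χ*χ*-mono-≤ : ∀ p q r {c d} → (p ≡ true → q ≡ true → r ≡ true → c ≤ d) →
  χ p * (χ q * χ r) * c ≤ χ p * (χ q * χ r) * d
χ*χ*χ*-mono-≤ true  true  true  c≤d = *-monoʳ-≤ 1 (c≤d refl refl refl)
χ*χ*χ*-mono-≤ true  true  false c≤d = z≤n
χ*χ*χ*-mono-≤ true  false r     c≤d = z≤n
χ*χ*χ*-mono-≤ false q     r     c≤d = z≤n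

countFin≡∑χ : ∀ {n} (p : Fin n → Bool) → countFin p ≡ ∑[ i < n ] χ (p i)
countFin≡∑χ {zero}  p = refl
countFin≡∑χ {suc n} p with p zero
... | true  = cong suc (countFin≡∑χ (p ∘ suc))
... | false = countFin≡∑χ (p ∘ suc)

≤countFin⇒embedding : ∀ {n t} (p : Fin n → Bool) → t ≤ countFin p →
  Σ (Fin t → Fin n) λ f → Injective _≡_ _≡_ f × (∀ k → p (f k) ≡ true)
≤countFin⇒embedding {t = zero} p _ = (λ ()) , (λ { {()} }) , (λ ())
≤countFin⇒embedding {zero} {suc t} p ()
≤countFin⇒embedding {suc n} {suc t} p t≤count with p zero in p₀
... | false = let f , f-inj , pf = ≤countFin⇒embedding (p ∘ suc) t≤count
              in suc ∘ f , f-inj ∘ suc-injective , pf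
... | true  = let f , f-inj , pf = ≤countFin⇒embedding (p ∘ suc) (s≤s⁻¹ t≤count)
              in cons f , cons-inj f-inj , cons-p pf
  where
  cons : (Fin t → Fin n) → Fin (suc t) → Fin (suc n)
  cons f zero    = zero
  cons f (suc k) = suc (f k)
  cons-inj : ∀ {f} → Injective _≡_ _≡_ f → Injective _≡_ _≡_ (cons f)
  cons-inj f-inj {zero}  {zero}  _  = refl
  cons-inj f-inj {suc k} {suc l} eq = cong suc (f-inj (suc-injective eq))
  cons-p : ∀ {f} → (∀ k → p (suc (f k)) ≡ true) → ∀ k → p (cons f k) ≡ true
  cons-p pf zero    = p₀
  cons-p pf (suc k) = pf k

∣_∣ : ∀ {n} → (Fin n → Bool) → ℕ
∣ X ∣ = countFin X

∁ : ∀ {n} → (Fin n → Bool) → Fin n → Bool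
∁ X = not ∘ X

∣X∣+∣∁X∣≡n : ∀ {n} (X : Fin n → Bool) → ∣ X ∣ + ∣ ∁ X ∣ ≡ n
∣X∣+∣∁X∣≡n {n} X = begin
  ∣ X ∣ + ∣ ∁ X ∣                                ≡⟨ cong₂ _+_ (countFin≡∑χ X) (countFin≡∑χ (∁ X)) ⟩
  ∑[ i < n ] χ (X i) + ∑[ i < n ] χ (not (X i))  ≡⟨ ∑-distrib-+ (χ ∘ X) (χ ∘ ∁ X) ⟨
  ∑[ i < n ] (χ (X i) + χ (not (X i)))          ≡⟨ sum-cong-≗ (χ-+-not ∘ X) ⟩
  ∑[ i < n ] 1                                  ≡⟨ ∑1≡n n ⟩
  n                                             ∎
  where
  open ≡-Reasoning
  ∑1≡n : ∀ n → ∑[ i < n ] 1 ≡ n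
  ∑1≡n zero    = refl
  ∑1≡n (suc n) = cong suc (∑1≡n n)

n∸∣X∣≡∣∁X∣ : ∀ {n} (X : Fin n → Bool) → n ∸ ∣ X ∣ ≡ ∣ ∁ X ∣
n∸∣X∣≡∣∁X∣ X = trans (cong (_∸ ∣ X ∣) (sym (∣X∣+∣∁X∣≡n X))) (m+n∸m≡n ∣ X ∣ ∣ ∁ X ∣)

-- Edges and non-edges between vertex sets

module _ {n} (G : Graph n) where

  -- Every vertex is a non-neighbour of itself, so nonDegIn Y i counts i when i ∈ Y.
  degIn nonDegIn : (Fin n → Bool) → Fin n → ℕ
  degIn    Y i = ∑[ j < n ] (χ (Y j) * χ (adj G i j))
  nonDegIn Y i = ∑[ j < n ] (χ (Y j) * χ (not (adj G i j)))

  -- Ordered pairs: edgesBetween X X is twice the number of edges inside X.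
  edgesBetween nonEdgesBetween : (Fin n → Bool) → (Fin n → Bool) → ℕ
  edgesBetween    X Y = ∑[ i < n ] (χ (X i) * degIn Y i)
  nonEdgesBetween X Y = ∑[ i < n ] (χ (X i) * nonDegIn Y i)

  edgeIn : (Fin n → Bool) → Fin n → Fin n → ℕ
  edgeIn X i j = χ (X i) * (χ (X j) * χ (adj G i j))

  degree≤maxDegree : ∀ i → degree G i ≤ maxDegree G
  degree≤maxDegree = f≤maxFin (degree G)

  degIn+nonDegIn≡∣Y∣ : ∀ Y i → degIn Y i + nonDegIn Y i ≡ ∣ Y ∣
  degIn+nonDegIn≡∣Y∣ Y i = begin
    degIn Y i + nonDegIn Y i
      ≡⟨ ∑-distrib-+ (λ j → χ (Y j) * χ (adj G i j)) (λ j → χ (Y j) * χ (not (adj G i j))) ⟨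
    ∑[ j < n ] (χ (Y j) * χ (adj G i j) + χ (Y j) * χ (not (adj G i j)))
      ≡⟨ sum-cong-≗ (λ j → χ-partitionʳ (χ (Y j)) (adj G i j)) ⟩
    ∑[ j < n ] χ (Y j)
      ≡⟨ countFin≡∑χ Y ⟨
    ∣ Y ∣ ∎
    where open ≡-Reasoning

  degree≡degIn+degIn∁ : ∀ X i → degree G i ≡ degIn X i + degIn (∁ X) i
  degree≡degIn+degIn∁ X i = begin
    degree G i
      ≡⟨ countFin≡∑χ (adj G i) ⟩
    ∑[ j < n ] χ (adj G i j)
      ≡⟨ sum-cong-≗ (λ j → χ-partitionˡ (X j) (χ (adj G i j))) ⟨
    ∑[ j < n ] (χ (X j) * χ (adj G i j) + χ (not (X j)) * χ (adj G i j))
      ≡⟨ ∑-distrib-+ (λ j → χ (X j) * χ (adj G i j)) (λ j → χ (not (X j)) * χ (adj G i j)) ⟩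
    degIn X i + degIn (∁ X) i ∎
    where open ≡-Reasoning

  edgesBetween+nonEdgesBetween≡∣X∣*∣Y∣ : ∀ X Y → edgesBetween X Y + nonEdgesBetween X Y ≡ ∣ X ∣ * ∣ Y ∣
  edgesBetween+nonEdgesBetween≡∣X∣*∣Y∣ X Y = begin
    edgesBetween X Y + nonEdgesBetween X Y
      ≡⟨ ∑-distrib-+ (λ i → χ (X i) * degIn Y i) (λ i → χ (X i) * nonDegIn Y i) ⟨
    ∑[ i < n ] (χ (X i) * degIn Y i + χ (X i) * nonDegIn Y i)
      ≡⟨ sum-cong-≗ (λ i → trans (sym (*-distribˡ-+ (χ (X i)) _ _)) (cong (χ (X i) *_) (degIn+nonDegIn≡∣Y∣ Y i))) ⟩
    ∑[ i < n ] (χ (X i) * ∣ Y ∣)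
      ≡⟨ *-distribʳ-sum ∣ Y ∣ (χ ∘ X) ⟨
    (∑[ i < n ] χ (X i)) * ∣ Y ∣
      ≡⟨ cong (_* ∣ Y ∣) (countFin≡∑χ X) ⟨
    ∣ X ∣ * ∣ Y ∣ ∎
    where open ≡-Reasoning

  nonEdgesBetween-comm : ∀ X Y → nonEdgesBetween X Y ≡ nonEdgesBetween Y X
  nonEdgesBetween-comm X Y = begin
    nonEdgesBetween X Y
      ≡⟨ sum-cong-≗ (λ i → *-distribˡ-sum (χ (X i)) (λ j → χ (Y j) * ā i j)) ⟩
    ∑[ i < n ] ∑[ j < n ] (χ (X i) * (χ (Y j) * ā i j))
      ≡⟨ ∑-comm (λ i j → χ (X i) * (χ (Y j) * ā i j)) ⟩
    ∑[ j < n ] ∑[ i < n ] (χ (X i) * (χ (Y j) * ā i j))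
      ≡⟨ sum-cong-≗ (λ j → sum-cong-≗ (λ i → transpose i j)) ⟩
    ∑[ j < n ] ∑[ i < n ] (χ (Y j) * (χ (X i) * ā j i))
      ≡⟨ sum-cong-≗ (λ j → *-distribˡ-sum (χ (Y j)) (λ i → χ (X i) * ā j i)) ⟨
    nonEdgesBetween Y X ∎
    where
    open ≡-Reasoning
    ā : Fin n → Fin n → ℕ
    ā i j = χ (not (adj G i j))
    x*[y*z]≡y*[x*z] : ∀ x y z → x * (y * z) ≡ y * (x * z)
    x*[y*z]≡y*[x*z] = solve-∀
    transpose : ∀ i j → χ (X i) * (χ (Y j) * ā i j) ≡ χ (Y j) * (χ (X i) * ā j i)
    transpose i j rewrite Graph.sym G i j = x*[y*z]≡y*[x*z] (χ (X i)) (χ (Y j)) (ā j i)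

  edgeIn-sym : ∀ X i j → edgeIn X i j ≡ edgeIn X j i
  edgeIn-sym X i j rewrite Graph.sym G i j = x*[y*z]≡y*[x*z] (χ (X i)) (χ (X j)) (χ (adj G j i))
    where
    x*[y*z]≡y*[x*z] : ∀ x y z → x * (y * z) ≡ y * (x * z)
    x*[y*z]≡y*[x*z] = solve-∀

  ∑∑edgeIn*≡∑χ*degIn* : ∀ X (c : Fin n → ℕ) →
    ∑[ i < n ] ∑[ j < n ] (edgeIn X i j * c i) ≡ ∑[ i < n ] (χ (X i) * degIn X i * c i)
  ∑∑edgeIn*≡∑χ*degIn* X c = sum-cong-≗ λ i → begin
    ∑[ j < n ] (edgeIn X i j * c i)     ≡⟨ *-distribʳ-sum (c i) (edgeIn X i) ⟨
    (∑[ j < n ] edgeIn X i j) * c i     ≡⟨ cong (_* c i) (*-distribˡ-sum (χ (X i)) (λ j → χ (X j) * χ (adj G i j))) ⟨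
    χ (X i) * degIn X i * c i           ∎
    where open ≡-Reasoning

  ∑χ*degIn*nonDegIn≤t*nonEdgesBetween : ∀ X Y {t} → (∀ x → X x ≡ true → degIn X x ≤ t) →
    ∑[ i < n ] (χ (X i) * degIn X i * nonDegIn Y i) ≤ t * nonEdgesBetween X Y
  ∑χ*degIn*nonDegIn≤t*nonEdgesBetween X Y {t} degIn≤t = begin
    ∑[ i < n ] (χ (X i) * degIn X i * nonDegIn Y i)
      ≤⟨ sum-mono-≤ (λ i → *-monoˡ-≤ (nonDegIn Y i) (χ*-mono-≤ (X i) (degIn≤t i))) ⟩
    ∑[ i < n ] (χ (X i) * t * nonDegIn Y i)
      ≡⟨ sum-cong-≗ (λ i → x*t*y≡t*[x*y] (χ (X i)) t (nonDegIn Y i)) ⟩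
    ∑[ i < n ] (t * (χ (X i) * nonDegIn Y i))
      ≡⟨ *-distribˡ-sum t (λ i → χ (X i) * nonDegIn Y i) ⟨
    t * nonEdgesBetween X Y ∎
    where
    open ≤-Reasoning
    x*t*y≡t*[x*y] : ∀ x t y → x * t * y ≡ t * (x * y)
    x*t*y≡t*[x*y] = solve-∀

  ∑χ*degree≡edgesBetween+edgesBetween∁ : ∀ Y X →
    ∑[ i < n ] (χ (Y i) * degree G i) ≡ edgesBetween Y X + edgesBetween Y (∁ X)
  ∑χ*degree≡edgesBetween+edgesBetween∁ Y X = begin
    ∑[ i < n ] (χ (Y i) * degree G i)
      ≡⟨ sum-cong-≗ (λ i → trans (cong (χ (Y i) *_) (degree≡degIn+degIn∁ X i)) (*-distribˡ-+ (χ (Y i)) _ _)) ⟩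
    ∑[ i < n ] (χ (Y i) * degIn X i + χ (Y i) * degIn (∁ X) i)
      ≡⟨ ∑-distrib-+ (λ i → χ (Y i) * degIn X i) (λ i → χ (Y i) * degIn (∁ X) i) ⟩
    edgesBetween Y X + edgesBetween Y (∁ X) ∎
    where open ≡-Reasoning

  ∑degree≡∑edgesBetween : ∀ X → ∑[ i < n ] degree G i ≡
    edgesBetween X X + edgesBetween X (∁ X) + (edgesBetween (∁ X) X + edgesBetween (∁ X) (∁ X))
  ∑degree≡∑edgesBetween X = begin
    ∑[ i < n ] degree G i
      ≡⟨ sum-cong-≗ (λ i → χ-partitionˡ (X i) (degree G i)) ⟨
    ∑[ i < n ] (χ (X i) * degree G i + χ (not (X i)) * degree G i)
      ≡⟨ ∑-distrib-+ (λ i → χ (X i) * degree G i) (λ i → χ (not (X i)) * degree G i) ⟩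
    ∑[ i < n ] (χ (X i) * degree G i) + ∑[ i < n ] (χ (not (X i)) * degree G i)
      ≡⟨ cong₂ _+_ (∑χ*degree≡edgesBetween+edgesBetween∁ X X) (∑χ*degree≡edgesBetween+edgesBetween∁ (∁ X) X) ⟩
    edgesBetween X X + edgesBetween X (∁ X) + (edgesBetween (∁ X) X + edgesBetween (∁ X) (∁ X)) ∎
    where open ≡-Reasoning

  private
    forward : Fin n → Fin n → ℕ
    forward i j = χ ((i <ᵇF j) ∧ adj G i j)

    adjacent≡forward+backward : ∀ i j → χ (adj G i j) ≡ forward i j + forward j i
    adjacent≡forward+backward i j
      with i <ᵇF j | <ᵇ-reflects-< (toℕ i) (toℕ j) | j <ᵇF i | <ᵇ-reflects-< (toℕ j) (toℕ i)
    ... | true  | ofʸ i<j | true  | ofʸ j<i = ⊥-elim (<-asym i<j j<i)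
    ... | true  | ofʸ _   | false | ofⁿ _   = sym (+-identityʳ _)
    ... | false | ofⁿ _   | true  | ofʸ _   = cong χ (Graph.sym G i j)
    ... | false | ofⁿ i≮j | false | ofⁿ j≮i
      rewrite toℕ-injective (≤-antisym (≮⇒≥ j≮i) (≮⇒≥ i≮j)) | Graph.irrefl G j = refl

  ∑degree≡2*edgeCount : ∑[ i < n ] degree G i ≡ 2 * edgeCount G
  ∑degree≡2*edgeCount = begin
    ∑[ i < n ] degree G i
      ≡⟨ sum-cong-≗ (λ i → trans (countFin≡∑χ (adj G i)) (sum-cong-≗ (adjacent≡forward+backward i))) ⟩
    ∑[ i < n ] ∑[ j < n ] (forward i j + forward j i)
      ≡⟨ ∑∑-distrib-+ forward (λ i j → forward j i) ⟩
    K + ∑[ i < n ] ∑[ j < n ] forward j i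
      ≡⟨ cong (K +_) (∑-comm (λ i j → forward j i)) ⟩
    K + K
      ≡⟨ cong (λ k → k + k) K≡edgeCount ⟩
    edgeCount G + edgeCount G
      ≡⟨ cong (edgeCount G +_) (+-identityʳ (edgeCount G)) ⟨
    2 * edgeCount G ∎
    where
    open ≡-Reasoning
    K : ℕ
    K = ∑[ i < n ] ∑[ j < n ] forward i j
    K≡edgeCount : K ≡ edgeCount G
    K≡edgeCount = sym (begin
      edgeCount G
        ≡⟨ sumFin≡sum (λ i → countFin (λ j → (i <ᵇF j) ∧ adj G i j)) ⟩
      ∑[ i < n ] countFin (λ j → (i <ᵇF j) ∧ adj G i j)
        ≡⟨ sum-cong-≗ (λ i → countFin≡∑χ (λ j → (i <ᵇF j) ∧ adj G i j)) ⟩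
      K ∎)

  excess-identity : ∀ X →
    2 * edgeCount G + nonEdgesBetween X (∁ X) + nonEdgesBetween (∁ X) X ≡
    edgesBetween X X + edgesBetween (∁ X) (∁ X) + 2 * (∣ X ∣ * ∣ ∁ X ∣)
  excess-identity X = begin
    2 * edgeCount G + N₁ + N₂
      ≡⟨ cong (λ s → s + N₁ + N₂) (trans (sym ∑degree≡2*edgeCount) (∑degree≡∑edgesBetween X)) ⟩
    AA + AB + (BA + BB) + N₁ + N₂
      ≡⟨ regroup AA AB BA BB N₁ N₂ ⟩
    AA + BB + ((AB + N₁) + (BA + N₂))
      ≡⟨ cong (AA + BB +_) (cong₂ _+_ (edgesBetween+nonEdgesBetween≡∣X∣*∣Y∣ X (∁ X))
                                       (edgesBetween+nonEdgesBetween≡∣X∣*∣Y∣ (∁ X) X)) ⟩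
    AA + BB + (∣ X ∣ * ∣ ∁ X ∣ + ∣ ∁ X ∣ * ∣ X ∣)
      ≡⟨ cong (AA + BB +_) (xy+yx≡2xy ∣ X ∣ ∣ ∁ X ∣) ⟩
    AA + BB + 2 * (∣ X ∣ * ∣ ∁ X ∣) ∎
    where
    open ≡-Reasoning
    AA AB BA BB N₁ N₂ : ℕ
    AA = edgesBetween X X
    AB = edgesBetween X (∁ X)
    BA = edgesBetween (∁ X) X
    BB = edgesBetween (∁ X) (∁ X)
    N₁ = nonEdgesBetween X (∁ X)
    N₂ = nonEdgesBetween (∁ X) X
    regroup : ∀ aa ab ba bb n₁ n₂ → aa + ab + (ba + bb) + n₁ + n₂ ≡ aa + bb + ((ab + n₁) + (ba + n₂))
    regroup = solve-∀
    xy+yx≡2xy : ∀ x y → x * y + y * x ≡ 2 * (x * y)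
    xy+yx≡2xy = solve-∀

  edgesBetween-∁≤nonEdgesBetween : ∀ X Y → (∀ i → degree G i ≤ ∣ X ∣) →
    edgesBetween Y (∁ X) ≤ nonEdgesBetween Y X
  edgesBetween-∁≤nonEdgesBetween X Y degree≤∣X∣ =
    sum-mono-≤ λ i → *-monoʳ-≤ (χ (Y i)) (+-cancelˡ-≤ (degIn X i) _ _ (begin
      degIn X i + degIn (∁ X) i    ≡⟨ degree≡degIn+degIn∁ X i ⟨
      degree G i                   ≤⟨ degree≤∣X∣ i ⟩
      ∣ X ∣                        ≡⟨ degIn+nonDegIn≡∣Y∣ X i ⟨
      degIn X i + nonDegIn X i     ∎))
    where open ≤-Reasoning

  edgesBetween-self>0 : ∀ X {i j} → X i ≡ true → X j ≡ true → adj G i j ≡ true → 0 < edgesBetween X X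
  edgesBetween-self>0 X {i} {j} Xi Xj ij = begin-strict
    0                           <⟨ z<s ⟩
    1                           ≡⟨ cong₂ (λ p q → χ p * χ q) Xj ij ⟨
    χ (X j) * χ (adj G i j)     ≤⟨ term≤sum (λ k → χ (X k) * χ (adj G i k)) j ⟩
    degIn X i                   ≡⟨ *-identityˡ (degIn X i) ⟨
    1 * degIn X i               ≡⟨ cong (λ p → χ p * degIn X i) Xi ⟨
    χ (X i) * degIn X i         ≤⟨ term≤sum (λ k → χ (X k) * degIn X k) i ⟩
    edgesBetween X X            ∎
    where open ≤-Reasoning

  triangle⇒edge-outside : ∀ X → HasTriangle G → edgesBetween X X ≡ 0 →
    Σ (Fin n) λ y → Σ (Fin n) λ z → adj G y z ≡ true × X y ≡ false × X z ≡ false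
  triangle⇒edge-outside X (x , y , z , xy , yz , xz) noEdges with X x in Xx | X y in Xy | X z in Xz
  ... | true  | true  | _     = contradiction (edgesBetween-self>0 X Xx Xy xy) (<-irrefl (sym noEdges))
  ... | true  | false | true  = contradiction (edgesBetween-self>0 X Xx Xz xz) (<-irrefl (sym noEdges))
  ... | true  | false | false = y , z , yz , Xy , Xz
  ... | false | true  | true  = contradiction (edgesBetween-self>0 X Xy Xz yz) (<-irrefl (sym noEdges))
  ... | false | true  | false = x , z , xz , Xx , Xz
  ... | false | false | _     = x , y , xy , Xx , Xy

  nonDegIn+nonDegIn≤nonEdgesBetween : ∀ X {y z} → adj G y z ≡ true → X y ≡ false → X z ≡ false →
    nonDegIn X y + nonDegIn X z ≤ nonEdgesBetween (∁ X) X
  nonDegIn+nonDegIn≤nonEdgesBetween X {y} {z} yz Xy Xz =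
    subst (_≤ nonEdgesBetween (∁ X) X) (cong₂ _+_ (outside Xy) (outside Xz))
      (two-terms≤sum (λ i → χ (not (X i)) * nonDegIn X i) y≢z)
    where
    outside : ∀ {i} → X i ≡ false → χ (not (X i)) * nonDegIn X i ≡ nonDegIn X i
    outside {i} Xi rewrite Xi = +-identityʳ (nonDegIn X i)
    y≢z : y ≢ z
    y≢z refl with trans (sym yz) (Graph.irrefl G y)
    ... | ()

maxDegree-attained : ∀ {n} (G : Graph (suc n)) → Σ (Fin (suc n)) λ v → degree G v ≡ maxDegree G
maxDegree-attained G = maxFin-attained (degree G)

-- Consequences of B_t-freeness

module _ {n} (G : Graph n) {t} (bookFree : BookFree t G) where

  commonNeighbours<t : ∀ {x y} → adj G x y ≡ true → countFin (λ j → adj G x j ∧ adj G y j) < t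
  commonNeighbours<t {x} {y} xy = ≰⇒> λ t≤common →
    let f , f-inj , common = ≤countFin⇒embedding (λ j → adj G x j ∧ adj G y j) t≤common
    in bookFree (x , y , xy , f , f-inj , λ k → ∧-conicalˡ _ _ (common k) , ∧-conicalʳ _ _ (common k))

  degIn-neighbourhood<t : ∀ {v x} → adj G v x ≡ true → degIn G (adj G v) x < t
  degIn-neighbourhood<t {v} {x} vx = begin-strict
    degIn G (adj G v) x                       ≡⟨ sum-cong-≗ (λ j → χ-∧ (adj G v j) (adj G x j)) ⟨
    ∑[ j < n ] χ (adj G v j ∧ adj G x j)      ≡⟨ countFin≡∑χ (λ j → adj G v j ∧ adj G x j) ⟨
    countFin (λ j → adj G v j ∧ adj G x j)    <⟨ commonNeighbours<t vx ⟩
    t                                         ∎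
    where open ≤-Reasoning

  ∣W∣≤nonDegIn+nonDegIn+t : ∀ W {x y} → adj G x y ≡ true → ∣ W ∣ ≤ nonDegIn G W x + nonDegIn G W y + t
  ∣W∣≤nonDegIn+nonDegIn+t W {x} {y} xy = begin
    ∣ W ∣
      ≡⟨ countFin≡∑χ W ⟩
    ∑[ j < n ] χ (W j)
      ≤⟨ sum-mono-≤ (λ j → χ-≤-cover (W j) (adj G x j) (adj G y j)) ⟩
    ∑[ j < n ] (χ (W j) * χ (not (adj G x j)) + χ (W j) * χ (not (adj G y j)) + χ (adj G x j ∧ adj G y j))
      ≡⟨ ∑-distrib-+ (λ j → χ (W j) * χ (not (adj G x j)) + χ (W j) * χ (not (adj G y j)))
                     (λ j → χ (adj G x j ∧ adj G y j)) ⟩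
    ∑[ j < n ] (χ (W j) * χ (not (adj G x j)) + χ (W j) * χ (not (adj G y j))) + ∑[ j < n ] χ (adj G x j ∧ adj G y j)
      ≡⟨ cong₂ _+_ (∑-distrib-+ (λ j → χ (W j) * χ (not (adj G x j))) (λ j → χ (W j) * χ (not (adj G y j))))
                   (sym (countFin≡∑χ (λ j → adj G x j ∧ adj G y j))) ⟩
    nonDegIn G W x + nonDegIn G W y + countFin (λ j → adj G x j ∧ adj G y j)
      ≤⟨ +-monoʳ-≤ _ (<⇒≤ (commonNeighbours<t xy)) ⟩
    nonDegIn G W x + nonDegIn G W y + t ∎
    where open ≤-Reasoning

  edgesBetween-self*∣Y∣≤ : ∀ X Y →
    edgesBetween G X X * ∣ Y ∣ ≤ 2 * ∑[ i < n ] (χ (X i) * degIn G X i * nonDegIn G Y i) + t * edgesBetween G X X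
  edgesBetween-self*∣Y∣≤ X Y = begin
    s * ∣ Y ∣
      ≡⟨ *-distribʳ-sum ∣ Y ∣ (λ i → χ (X i) * degIn G X i) ⟩
    ∑[ i < n ] (χ (X i) * degIn G X i * ∣ Y ∣)
      ≡⟨ ∑∑edgeIn*≡∑χ*degIn* G X (λ _ → ∣ Y ∣) ⟨
    ∑[ i < n ] ∑[ j < n ] (w i j * ∣ Y ∣)
      ≤⟨ sum-mono-≤ (λ i → sum-mono-≤ (λ j → χ*χ*χ*-mono-≤ (X i) (X j) (adj G i j)
                                              (λ _ _ → ∣W∣≤nonDegIn+nonDegIn+t Y))) ⟩
    ∑[ i < n ] ∑[ j < n ] (w i j * (ν i + ν j + t))
      ≡⟨ sum-cong-≗ (λ i → sum-cong-≗ (λ j → *-distribˡ-+₃ (w i j) (ν i) (ν j) t)) ⟩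
    ∑[ i < n ] ∑[ j < n ] (w i j * ν i + w i j * ν j + w i j * t)
      ≡⟨ trans (∑∑-distrib-+ (λ i j → w i j * ν i + w i j * ν j) (λ i j → w i j * t))
               (cong (_+ ∑[ i < n ] ∑[ j < n ] (w i j * t)) (∑∑-distrib-+ (λ i j → w i j * ν i) (λ i j → w i j * ν j))) ⟩
    ∑[ i < n ] ∑[ j < n ] (w i j * ν i) + ∑[ i < n ] ∑[ j < n ] (w i j * ν j) + ∑[ i < n ] ∑[ j < n ] (w i j * t)
      ≡⟨ cong₂ _+_ (cong₂ _+_ (∑∑edgeIn*≡∑χ*degIn* G X ν)
                              (trans (∑∑-symmetric-weight w ν (edgeIn-sym G X)) (∑∑edgeIn*≡∑χ*degIn* G X ν)))
                   (trans (∑∑edgeIn*≡∑χ*degIn* G X (λ _ → t)) (sym (*-distribʳ-sum t (λ i → χ (X i) * degIn G X i)))) ⟩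
    T + T + s * t
      ≡⟨ x+x+y*z≡2x+z*y T s t ⟩
    2 * T + t * s ∎
    where
    open ≤-Reasoning
    s T : ℕ
    s = edgesBetween G X X
    T = ∑[ i < n ] (χ (X i) * degIn G X i * nonDegIn G Y i)
    ν : Fin n → ℕ
    ν = nonDegIn G Y
    w : Fin n → Fin n → ℕ
    w = edgeIn G X
    *-distribˡ-+₃ : ∀ w a b c → w * (a + b + c) ≡ w * a + w * b + w * c
    *-distribˡ-+₃ = solve-∀
    x+x+y*z≡2x+z*y : ∀ x y z → x + x + y * z ≡ 2 * x + z * y
    x+x+y*z≡2x+z*y = solve-∀

s*m≤2te+ts⇒s≤e : ∀ {t m s e} .{{_ : NonZero t}} → 3 * t ≤ m → s * m ≤ 2 * (t * e) + t * s → s ≤ e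
s*m≤2te+ts⇒s≤e {t} {m} {s} {e} 3t≤m bound =
  *-cancelˡ-≤ 2 (*-cancelˡ-≤ t (+-cancelʳ-≤ (t * s) (t * (2 * s)) (t * (2 * e)) (begin
    t * (2 * s) + t * s       ≡⟨ lhs t s ⟩
    s * (3 * t)               ≤⟨ *-monoʳ-≤ s 3t≤m ⟩
    s * m                     ≤⟨ bound ⟩
    2 * (t * e) + t * s       ≡⟨ rhs t e s ⟩
    t * (2 * e) + t * s       ∎)))
  where
  open ≤-Reasoning
  lhs : ∀ t s → t * (2 * s) + t * s ≡ s * (3 * t)
  lhs = solve-∀
  rhs : ∀ t e s → 2 * (t * e) + t * s ≡ t * (2 * e) + t * s
  rhs = solve-∀

s*m≤2te+ts⇒4tbs+n≤4tbe : ∀ {t b m n s e} → 0 < s → 6 * t * b ≤ n → n ≤ b * m →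
  s * m ≤ 2 * (t * e) + t * s → 4 * t * b * s + n ≤ 4 * t * b * e
s*m≤2te+ts⇒4tbs+n≤4tbe {t} {b} {m} {n} {s} {e} 0<s 6tb≤n n≤bm bound =
  +-cancelʳ-≤ (2 * t * b * s) (4 * t * b * s + n) (4 * t * b * e) (begin
    4 * t * b * s + n + 2 * t * b * s    ≡⟨ lhs t b s n ⟩
    s * (6 * t * b) + 1 * n              ≤⟨ +-mono-≤ (*-monoʳ-≤ s 6tb≤n) (*-monoˡ-≤ n 0<s) ⟩
    s * n + s * n                        ≤⟨ +-mono-≤ (*-monoʳ-≤ s n≤bm) (*-monoʳ-≤ s n≤bm) ⟩
    s * (b * m) + s * (b * m)            ≡⟨ middle s b m ⟩
    2 * b * (s * m)                      ≤⟨ *-monoʳ-≤ (2 * b) bound ⟩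
    2 * b * (2 * (t * e) + t * s)        ≡⟨ rhs t b e s ⟩
    4 * t * b * e + 2 * t * b * s        ∎)
  where
  open ≤-Reasoning
  lhs : ∀ t b s n → 4 * t * b * s + n + 2 * t * b * s ≡ s * (6 * t * b) + 1 * n
  lhs = solve-∀
  middle : ∀ s b m → s * (b * m) + s * (b * m) ≡ 2 * b * (s * m)
  middle = solve-∀
  rhs : ∀ t b e s → 2 * b * (2 * (t * e) + t * s) ≡ 4 * t * b * e + 2 * t * b * s
  rhs = solve-∀

n<2Δ≤2[e+t]⇒n≤4tbe : ∀ {t b n Δ e} .{{_ : NonZero t}} .{{_ : NonZero b}} →
  6 * t * b ≤ n → n < 2 * Δ → Δ ≤ e + t → n ≤ 4 * t * b * e
n<2Δ≤2[e+t]⇒n≤4tbe {t} {b} {n} {Δ} {e} 6tb≤n n<2Δ Δ≤e+t = ≤-trans n≤4e (*-monoˡ-≤ e 4≤4tb)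
  where
  open ≤-Reasoning
  4≤4tb : 4 ≤ 4 * t * b
  4≤4tb = *-mono-≤ (*-monoʳ-≤ 4 (>-nonZero⁻¹ t)) (>-nonZero⁻¹ b)
  4t≤n : 4 * t ≤ n
  4t≤n = begin
    4 * t          ≤⟨ *-monoˡ-≤ t (s≤s (s≤s (s≤s (s≤s (z≤n {2}))))) ⟩
    6 * t          ≤⟨ m≤m*n (6 * t) b ⟩
    6 * t * b      ≤⟨ 6tb≤n ⟩
    n              ∎
  regroup : ∀ e t → 2 * (e + t) + 2 * (e + t) ≡ 4 * e + 4 * t
  regroup = solve-∀
  n≤4e : n ≤ 4 * e
  n≤4e = +-cancelʳ-≤ n n (4 * e) (begin
    n + n                        ≤⟨ +-mono-≤ (<⇒≤ n<2Δ) (<⇒≤ n<2Δ) ⟩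
    2 * Δ + 2 * Δ                ≤⟨ +-mono-≤ (*-monoʳ-≤ 2 Δ≤e+t) (*-monoʳ-≤ 2 Δ≤e+t) ⟩
    2 * (e + t) + 2 * (e + t)    ≡⟨ regroup e t ⟩
    4 * e + 4 * t                ≤⟨ +-monoʳ-≤ (4 * e) 4t≤n ⟩
    4 * e + n                    ∎)

b*Δ<a*n⇒n≤b*m : ∀ {a b Δ m n} → a < b → b * Δ < a * n → Δ + m ≡ n → n ≤ b * m
b*Δ<a*n⇒n≤b*m {a} {b} {Δ} {m} {n} a<b bΔ<an Δ+m≡n = +-cancelˡ-≤ (b * Δ) n (b * m) (begin
  b * Δ + n        ≤⟨ +-monoˡ-≤ n (<⇒≤ bΔ<an) ⟩
  a * n + n        ≡⟨ +-comm (a * n) n ⟩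
  suc a * n        ≤⟨ *-monoˡ-≤ n a<b ⟩
  b * n            ≡⟨ cong (b *_) Δ+m≡n ⟨
  b * (Δ + m)      ≡⟨ *-distribˡ-+ b Δ m ⟩
  b * Δ + b * m    ∎)
  where open ≤-Reasoning

excess-bound : ∀ {e n₁ n₂ x y d k} → e + n₁ + n₂ ≡ x + y + d → x + k ≤ n₁ → y ≤ n₂ → e + k ≤ d
excess-bound {e} {n₁} {n₂} {x} {y} {d} {k} identity x+k≤n₁ y≤n₂ =
  +-cancelʳ-≤ (n₁ + n₂) (e + k) d (begin
    e + k + (n₁ + n₂)     ≡⟨ shuffle e k n₁ n₂ ⟩
    e + n₁ + n₂ + k       ≡⟨ cong (_+ k) identity ⟩
    x + y + d + k         ≡⟨ shuffle′ x y d k ⟩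
    x + k + y + d         ≤⟨ +-monoˡ-≤ d (+-mono-≤ x+k≤n₁ y≤n₂) ⟩
    n₁ + n₂ + d           ≡⟨ +-comm (n₁ + n₂) d ⟩
    d + (n₁ + n₂)         ∎)
  where
  open ≤-Reasoning
  shuffle : ∀ e k n₁ n₂ → e + k + (n₁ + n₂) ≡ e + n₁ + n₂ + k
  shuffle = solve-∀
  shuffle′ : ∀ x y d k → x + y + d + k ≡ x + k + y + d
  shuffle′ = solve-∀

-- Around a vertex of maximum degree

module _ {n} (G : Graph n) {t} .{{_ : NonZero t}} (bookFree : BookFree t G) (v : Fin n)
         (v-max : ∀ i → degree G i ≤ degree G v) where

  private
    A B : Fin n → Bool
    A = adj G v
    B = ∁ A

    edges-in-neighbourhood :
      edgesBetween G A A * ∣ B ∣ ≤ 2 * (t * nonEdgesBetween G A B) + t * edgesBetween G A A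
    edges-in-neighbourhood = ≤-trans (edgesBetween-self*∣Y∣≤ G bookFree A B)
      (+-monoˡ-≤ _ (*-monoʳ-≤ 2 (∑χ*degIn*nonDegIn≤t*nonEdgesBetween G A B
        (λ _ vx → <⇒≤ (degIn-neighbourhood<t G bookFree vx)))))

    edges-in-complement : edgesBetween G B B ≤ nonEdgesBetween G B A
    edges-in-complement = edgesBetween-∁≤nonEdgesBetween G A B v-max

  edgeCount≤Δ*∣∁N∣ : 3 * t ≤ ∣ B ∣ → edgeCount G ≤ degree G v * ∣ B ∣
  edgeCount≤Δ*∣∁N∣ 3t≤m = *-cancelˡ-≤ 2 (≤-trans (m≤m+n _ 0)
    (excess-bound (excess-identity G A) AA+0≤ē edges-in-complement))
    where
    AA+0≤ē : edgesBetween G A A + 0 ≤ nonEdgesBetween G A B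
    AA+0≤ē = subst (_≤ nonEdgesBetween G A B) (sym (+-identityʳ _)) (s*m≤2te+ts⇒s≤e 3t≤m edges-in-neighbourhood)

  module _ {b} .{{_ : NonZero b}} (6tb≤n : 6 * t * b ≤ n) (n≤bm : n ≤ b * ∣ B ∣) (n<2Δ : n < 2 * degree G v)
           (triangle : HasTriangle G) where

    private
      Q ē : ℕ
      Q = 4 * t * b
      ē = nonEdgesBetween G A B

      Q*AA+n≤Q*ē : Q * edgesBetween G A A + n ≤ Q * ē
      Q*AA+n≤Q*ē with edgesBetween G A A in AA≡
      ... | suc s = s*m≤2te+ts⇒4tbs+n≤4tbe {t} {b} {∣ B ∣} {n} {suc s} {ē} z<s 6tb≤n n≤bm
                      (subst (λ s → s * ∣ B ∣ ≤ 2 * (t * ē) + t * s) AA≡ edges-in-neighbourhood)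
      ... | zero with triangle⇒edge-outside G A triangle AA≡
      ...   | y , z , yz , Ay , Az =
        subst (_≤ Q * ē) (cong (_+ n) (sym (*-zeroʳ Q))) (n<2Δ≤2[e+t]⇒n≤4tbe {t} {b} {n} {degree G v} {ē} 6tb≤n n<2Δ (begin
          degree G v                             ≤⟨ ∣W∣≤nonDegIn+nonDegIn+t G bookFree A yz ⟩
          nonDegIn G A y + nonDegIn G A z + t    ≤⟨ +-monoˡ-≤ t (nonDegIn+nonDegIn≤nonEdgesBetween G A yz Ay Az) ⟩
          nonEdgesBetween G B A + t              ≡⟨ cong (_+ t) (nonEdgesBetween-comm G B A) ⟩
          ē + t                                  ∎))
        where open ≤-Reasoning

      distrib₃ : ∀ c x y z → c * (x + y + z) ≡ c * x + c * y + c * z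
      distrib₃ = solve-∀

      scaled-excess-identity :
        Q * (2 * edgeCount G) + Q * ē + Q * nonEdgesBetween G B A ≡
        Q * edgesBetween G A A + Q * edgesBetween G B B + Q * (2 * (degree G v * ∣ B ∣))
      scaled-excess-identity =
        trans (sym (distrib₃ Q _ _ _)) (trans (cong (Q *_) (excess-identity G A)) (distrib₃ Q _ _ _))

    triangle⇒edgeCount+deficit≤Δ*∣∁N∣ : 4 * t * b * 2 * edgeCount G + n ≤ 4 * t * b * 2 * (degree G v * ∣ B ∣)
    triangle⇒edgeCount+deficit≤Δ*∣∁N∣ rewrite *-assoc Q 2 (edgeCount G) | *-assoc Q 2 (degree G v * ∣ B ∣) =
      excess-bound scaled-excess-identity Q*AA+n≤Q*ē (*-monoʳ-≤ Q edges-in-complement)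

lemma2p2 : (t : ℕ) → 1 ≤ t → (a b : ℕ) → a < b →
    Σ ℕ λ n₀ → Σ ℕ λ p → Σ ℕ λ q → 0 < p × 0 < q ×
    ((n : ℕ) → n₀ ≤ n → (G : Graph n) → BookFree t G →
    n < 2 * maxDegree G → b * maxDegree G < a * n →
    (edgeCount G ≤ maxDegree G * (n ∸ maxDegree G)) ×
    (HasTriangle G →
    q * edgeCount G + p * n ≤ q * (maxDegree G * (n ∸ maxDegree G))))
-- n₀ = 6tb makes |B| ≥ n/b ≥ 6t; q = 2 · 4tb because edgesBetween counts ordered pairs.
lemma2p2 t 1≤t a b a<b = 6 * t * b , 1 , 4 * t * b * 2 , z<s , 0<q , bounds
  where
  1≤b : 1 ≤ b
  1≤b = ≤-trans (s≤s z≤n) a<b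
  instance
    t≢0 : NonZero t
    t≢0 = >-nonZero 1≤t
    b≢0 : NonZero b
    b≢0 = >-nonZero 1≤b
  0<q : 0 < 4 * t * b * 2
  0<q = ≤-trans (s≤s z≤n) (*-mono-≤ (*-mono-≤ (*-monoʳ-≤ 4 1≤t) 1≤b) (s≤s (z≤n {1})))

  bounds : (n : ℕ) → 6 * t * b ≤ n → (G : Graph n) → BookFree t G →
    n < 2 * maxDegree G → b * maxDegree G < a * n →
    (edgeCount G ≤ maxDegree G * (n ∸ maxDegree G)) ×
    (HasTriangle G → 4 * t * b * 2 * edgeCount G + 1 * n ≤ 4 * t * b * 2 * (maxDegree G * (n ∸ maxDegree G)))
  bounds zero _ G _ () _
  bounds n@(suc _) 6tb≤n G bookFree n<2Δ bΔ<an with maxDegree-attained G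
  ... | v , deg-v≡Δ rewrite sym deg-v≡Δ | n∸∣X∣≡∣∁X∣ (adj G v) | *-identityˡ n =
    edgeCount≤Δ*∣∁N∣ G bookFree v v-max 3t≤m ,
    triangle⇒edgeCount+deficit≤Δ*∣∁N∣ G bookFree v v-max 6tb≤n n≤bm n<2Δ
    where
    v-max : ∀ i → degree G i ≤ degree G v
    v-max i = subst (degree G i ≤_) (sym deg-v≡Δ) (degree≤maxDegree G i)
    n≤bm : n ≤ b * ∣ ∁ (adj G v) ∣
    n≤bm = b*Δ<a*n⇒n≤b*m a<b bΔ<an (∣X∣+∣∁X∣≡n (adj G v))
    3t≤m : 3 * t ≤ ∣ ∁ (adj G v) ∣
    3t≤m = ≤-trans (*-monoˡ-≤ t (s≤s (s≤s (s≤s (z≤n {3})))))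
                   (*-cancelˡ-≤ b (subst (_≤ b * ∣ ∁ (adj G v) ∣) (*-comm (6 * t) b) (≤-trans 6tb≤n n≤bm)))
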